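{- Let $\mathcal{M}$ be a $2$-divisible multiset of points in $\mathrm{PG}(v-1,2)$ with cardinality $4$. Then either $\mathcal{M}=2\cdot\chi_{P_1}+2\cdot\chi_{P_2}$ for two points $P_1,P_2$ (which may be equal), or there exist a plane $E$ and a line $L\le E$ with $\mathcal{M}=\chi_E-\chi_L=\chi_{E\setminus L}$.
   Context: $\mathrm{PG}(v-1,2)$ is the projective geometry of $\mathbb{F}_2^v$; points, lines, planes, hyperplanes are subspaces of dimension $1$, $2$, $3$, $v-1$. A multiset of points $\mathcal{M}$ assigns to each point $P$ a multiplicity $\mathcal{M}(P)\in\{0,1,2,\dots\}$; $\mathcal{M}(K)=\sum_{P\le K}\mathcal{M}(P)$ for a subspace $K$, and $\#\mathcal{M}=\mathcal{M}(\mathbb{F}_2^v)$. $\mathcal{M}$ is $\Delta$-divisible if $\mathcal{M}(H)\equiv\#\mathcal{M}\pmod\Delta$ for every hyperplane $H$. For a subspace or set of points $K$, $\chi_K$ has multiplicity $1$ on the points of $K$ and $0$ elsewhere; operations on multisets are pointwise. -}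

module Defs where

open import Data.Bool using (Bool; true; false; _xor_; _∧_; _∨_; not; if_then_else_)
open import Data.Nat using (ℕ; zero; suc; _+_; _*_; _∸_; _%_; NonZero)
open import Data.List using (List; []; _∷_; map; filterᵇ; concatMap)
open import Data.Nat.ListAction using (sum)
open import Data.Bool.ListAction using (any)
open import Data.Vec using (Vec; []; _∷_; replicate; zipWith)
open import Data.Product using (Σ; _×_)
open import Data.Sum using (_⊎_)
open import Relation.Binary.PropositionalEquality using (_≡_)

-- The ambient space F_2^v : vectors of booleans (false = 0, true = 1, xor = +).
V : ℕ → Set
V v = Vec Bool v

allVecs : (v : ℕ) → List (V v)
allVecs zero = [] ∷ []
allVecs (suc v) = concatMap (λ x → (false ∷ x) ∷ (true ∷ x) ∷ []) (allVecs v)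

zeroV : (v : ℕ) → V v
zeroV v = replicate v false

_+V_ : {v : ℕ} → V v → V v → V v
x +V y = zipWith _xor_ x y

eqB : Bool → Bool → Bool
eqB a b = not (a xor b)

_==V_ : {v : ℕ} → V v → V v → Bool
[] ==V [] = true
(a ∷ x) ==V (b ∷ y) = eqB a b ∧ (x ==V y)

-- nonzero test; over F_2 the points of PG(v-1,2) (1-dim subspaces)
-- correspond bijectively to nonzero vectors
isNonzero : {v : ℕ} → V v → Bool
isNonzero [] = false
isNonzero (a ∷ x) = a ∨ isNonzero x

comb : {v k : ℕ} → Vec Bool k → Vec (V v) k → V v
comb {v} [] [] = zeroV v
comb (c ∷ cs) (g ∷ gs) = if c then g +V comb cs gs else comb cs gs

Independent : {v k : ℕ} → Vec (V v) k → Set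
Independent {v} {k} gs = (c : Vec Bool k) → comb c gs ≡ zeroV v → c ≡ replicate k false

inSpan : {v k : ℕ} → Vec (V v) k → V v → Bool
inSpan {v} {k} gs x = any (λ c → comb c gs ==V x) (allVecs k)

-- A k-dimensional subspace of F_2^v is given by a basis: an independent
-- family of k vectors; its points are the nonzero vectors of its span.
isPointOf : {v k : ℕ} → Vec (V v) k → V v → Bool
isPointOf gs x = isNonzero x ∧ inSpan gs x

-- multisets of points: multiplicity function (the value at the zero vector,
-- which is not a point, is ignored everywhere)
Multiset : ℕ → Set
Multiset v = V v → ℕ

mult : {v k : ℕ} → Multiset v → Vec (V v) k → ℕ
mult {v} M gs = sum (map M (filterᵇ (isPointOf gs) (allVecs v)))

card : {v : ℕ} → Multiset v → ℕ
card {v} M = sum (map M (filterᵇ isNonzero (allVecs v)))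

IsHyperplane : {v : ℕ} → Vec (V v) (v ∸ 1) → Set
IsHyperplane hs = Independent hs

Divisible : {v : ℕ} → (Δ : ℕ) → .{{NonZero Δ}} → Multiset v → Set
Divisible {v} Δ M = (hs : Vec (V v) (v ∸ 1)) → IsHyperplane hs →
  mult M hs % Δ ≡ card M % Δ

χpt : {v : ℕ} → V v → Multiset v
χpt P x = if x ==V P then 1 else 0

χ : {v k : ℕ} → Vec (V v) k → Multiset v
χ gs x = if isPointOf gs x then 1 else 0

_≤S_ : {v k l : ℕ} → Vec (V v) k → Vec (V v) l → Set
_≤S_ {v} K K' = (x : V v) → isPointOf K x ≡ true → isPointOf K' x ≡ true

_≈M_ : {v : ℕ} → Multiset v → Multiset v → Set
_≈M_ {v} M N = (x : V v) → isNonzero x ≡ true → M x ≡ N x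

-- Write M as a list of four points p₁, …, p₄ in which every point occurs with its multiplicity.
-- Intersecting with the coordinate hyperplanes xᵢ = 0 shows that each coordinate is 1 in an even
-- number of the pⱼ, so p₁ + p₂ + p₃ + p₄ = 0, i.e. p₄ = p₁ + p₂ + p₃. If two of p₁, p₂, p₃
-- coincide, the four points pair up and M = 2χ_P + 2χ_Q. Otherwise p₁, p₂, p₃ are independent,
-- and the plane E they span consists of the four pⱼ together with the line L = {p₁ + p₂, p₁ + p₃,
-- p₂ + p₃}, so M = χ_E − χ_L.
module Submission where

open import Defs
open import Algebra.Bundles using (CommutativeSemigroup)
import Algebra.Properties.CommutativeSemigroup as CommutativeSemigroupProperties
open import Data.Bool using (Bool; true; false; _xor_; not; if_then_else_)
open import Data.Bool.Properties
  using (_≟_; xor-assoc; xor-comm; xor-same; xor-identityʳ; T-≡; if-eta; if-swap-then)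
open import Data.Empty using (⊥-elim)
open import Data.Fin using (Fin; zero; suc)
open import Data.List as List using (List; []; _∷_; _++_; filterᵇ; concatMap; length)
open import Data.List.Membership.Propositional using (_∈_; _∉_)
open import Data.List.Membership.Propositional.Properties using (∈-concatMap⁺; ∈-map⁻)
open import Data.List.Properties using (map-++; map-cong; length-++; length-replicate)
open import Data.List.Relation.Binary.Permutation.Propositional as ↭ using (_↭_; prep; swap)
import Data.List.Relation.Binary.Permutation.Propositional.Properties as ↭
open import Data.List.Relation.Unary.All as All using (All; []; _∷_)
open import Data.List.Relation.Unary.Any as Any using (here; there)
open import Data.List.Relation.Unary.Any.Properties using (any⁺; any⁻)
open import Data.Nat using (ℕ; zero; suc; _+_; _*_; _∸_; _%_; _<_; z≤n; s≤s)
open import Data.Nat.DivMod using (%-distribˡ-+; m%n<n)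
open import Data.Nat.ListAction using (sum)
open import Data.Nat.ListAction.Properties using (sum-++; sum-↭)
open import Data.Nat.Properties
  using (0∸n≡0; +-identityʳ; +-commutativeSemigroup; m≤n+m; <-≤-trans; n≮n)
open import Data.Nat.Tactic.RingSolver using (solve-∀)
open import Data.Product using (Σ; ∃; _×_; _,_)
open import Data.Sum using (_⊎_; inj₁; inj₂)
open import Data.Vec as Vec using (Vec; []; _∷_; lookup; insertAt; removeAt)
open import Data.Vec.Properties
  using (≡-dec; ∷-injectiveˡ; ∷-injectiveʳ; zipWith-assoc; zipWith-comm; zipWith-identityˡ;
         zipWith-identityʳ; lookup-zipWith; lookup-replicate; insertAt-lookup; insertAt-removeAt)
open import Function using (_∘_; Equivalence)
open import Relation.Binary.PropositionalEquality
open import Relation.Binary.PropositionalEquality.Algebra using (isMagma)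
open import Relation.Nullary using (¬_; Dec; yes; no; _because_)
open import Relation.Nullary.Reflects using (Reflects; ofʸ; ofⁿ; invert; det; fromEquivalence)

open ≡-Reasoning

private
  variable
    A B : Set
    n v k l : ℕ

Reflects-map : {P Q : Set} {b : Bool} → (P → Q) → (Q → P) → Reflects P b → Reflects Q b
Reflects-map to from (ofʸ p) = ofʸ (to p)
Reflects-map to from (ofⁿ ¬p) = ofⁿ (¬p ∘ from)

Reflects-true⇒ : {P : Set} {b : Bool} → Reflects P b → b ≡ true → P
Reflects-true⇒ r refl = invert r

Reflects-⇒true : {P : Set} {b : Bool} → Reflects P b → P → b ≡ true
Reflects-⇒true r p = det r (ofʸ p)

Reflects-¬⇒false : {P : Set} {b : Bool} → Reflects P b → ¬ P → b ≡ false
Reflects-¬⇒false r ¬p = det r (ofⁿ ¬p)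

sum-map-+ : (f g : A → ℕ) (xs : List A) →
  sum (List.map (λ x → f x + g x) xs) ≡ sum (List.map f xs) + sum (List.map g xs)
sum-map-+ f g [] = refl
sum-map-+ f g (x ∷ xs) = begin
  (f x + g x) + sum (List.map (λ x → f x + g x) xs)
    ≡⟨ cong ((f x + g x) +_) (sum-map-+ f g xs) ⟩
  (f x + g x) + (sum (List.map f xs) + sum (List.map g xs))
    ≡⟨ interchange (f x) (g x) _ _ ⟩
  (f x + sum (List.map f xs)) + (g x + sum (List.map g xs)) ∎
  where open CommutativeSemigroupProperties +-commutativeSemigroup using (interchange)

sum-map-concatMap : (f : B → ℕ) (g : A → List B) (xs : List A) →
  sum (List.map f (concatMap g xs)) ≡ sum (List.map (λ x → sum (List.map f (g x))) xs)
sum-map-concatMap f g [] = refl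
sum-map-concatMap f g (x ∷ xs) = begin
  sum (List.map f (g x ++ concatMap g xs))
    ≡⟨ cong sum (map-++ f (g x) _) ⟩
  sum (List.map f (g x) ++ List.map f (concatMap g xs))
    ≡⟨ sum-++ (List.map f (g x)) _ ⟩
  sum (List.map f (g x)) + sum (List.map f (concatMap g xs))
    ≡⟨ cong (sum (List.map f (g x)) +_) (sum-map-concatMap f g xs) ⟩
  sum (List.map f (g x)) + sum (List.map (λ x → sum (List.map f (g x))) xs) ∎

sum-map-filterᵇ : (p : A → Bool) (f : A → ℕ) (xs : List A) →
  sum (List.map f (filterᵇ p xs)) ≡ sum (List.map (λ x → if p x then f x else 0) xs)
sum-map-filterᵇ p f [] = refl
sum-map-filterᵇ p f (x ∷ xs) with p x
... | true = cong (f x +_) (sum-map-filterᵇ p f xs)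
... | false = sum-map-filterᵇ p f xs

sum-map-zero : (xs : List A) → sum (List.map (λ _ → 0) xs) ≡ 0
sum-map-zero [] = refl
sum-map-zero (x ∷ xs) = sum-map-zero xs

length-filterᵇ-∷ : (q : A → Bool) (p : A) (ps : List A) →
  length (filterᵇ q (p ∷ ps)) ≡ (if q p then 1 else 0) + length (filterᵇ q ps)
length-filterᵇ-∷ q p ps with q p
... | true = refl
... | false = refl

if-+ : (b : Bool) (m n : ℕ) → (if b then m + n else 0) ≡ (if b then m else 0) + (if b then n else 0)
if-+ true m n = refl
if-+ false m n = refl

+V-assoc : (x y z : V n) → (x +V y) +V z ≡ x +V (y +V z)
+V-assoc = zipWith-assoc xor-assoc

+V-comm : (x y : V n) → x +V y ≡ y +V x
+V-comm = zipWith-comm xor-comm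

+V-identityˡ : (x : V n) → zeroV n +V x ≡ x
+V-identityˡ = zipWith-identityˡ (λ _ → refl)

+V-identityʳ : (x : V n) → x +V zeroV n ≡ x
+V-identityʳ = zipWith-identityʳ xor-identityʳ

+V-self : (x : V n) → x +V x ≡ zeroV n
+V-self [] = refl
+V-self (a ∷ x) = cong₂ _∷_ (xor-same a) (+V-self x)

+V-commutativeSemigroup : ℕ → CommutativeSemigroup _ _
+V-commutativeSemigroup n = record
  { Carrier = V n
  ; _≈_ = _≡_
  ; _∙_ = _+V_
  ; isCommutativeSemigroup = record
    { isSemigroup = record { isMagma = isMagma _+V_ ; assoc = +V-assoc }
    ; comm = +V-comm
    }
  }

module _ {n : ℕ} where
  open CommutativeSemigroupProperties (+V-commutativeSemigroup n) public
    using () renaming (interchange to +V-interchange; x∙yz≈y∙xz to +V-leftCommutative)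

+V-cancelˡ : (x y : V n) → x +V (x +V y) ≡ y
+V-cancelˡ {n} x y = begin
  x +V (x +V y)  ≡⟨ +V-assoc x x y ⟨
  (x +V x) +V y  ≡⟨ cong (_+V y) (+V-self x) ⟩
  zeroV n +V y   ≡⟨ +V-identityˡ y ⟩
  y              ∎

+V≡zero⇒≡ : (x y : V n) → x +V y ≡ zeroV n → x ≡ y
+V≡zero⇒≡ {n} x y x+y≡0 = begin
  x                   ≡⟨ +V-identityʳ x ⟨
  x +V zeroV n        ≡⟨ cong (x +V_) (+V-self y) ⟨
  x +V (y +V y)       ≡⟨ +V-assoc x y y ⟨
  (x +V y) +V y       ≡⟨ cong (_+V y) x+y≡0 ⟩
  zeroV n +V y        ≡⟨ +V-identityˡ y ⟩
  y                   ∎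

isNonzero-zeroV : (n : ℕ) → isNonzero (zeroV n) ≡ false
isNonzero-zeroV zero = refl
isNonzero-zeroV (suc n) = isNonzero-zeroV n

nonzero⇒≢zeroV : {x : V n} → isNonzero x ≡ true → x ≢ zeroV n
nonzero⇒≢zeroV {n} nz refl with () ← trans (sym nz) (isNonzero-zeroV n)

==V-reflects : (x y : V n) → Reflects (x ≡ y) (x ==V y)
==V-reflects [] [] = ofʸ refl
==V-reflects (true ∷ x) (true ∷ y) = Reflects-map (cong (true ∷_)) ∷-injectiveʳ (==V-reflects x y)
==V-reflects (false ∷ x) (false ∷ y) = Reflects-map (cong (false ∷_)) ∷-injectiveʳ (==V-reflects x y)
==V-reflects (true ∷ x) (false ∷ y) = ofⁿ λ ()
==V-reflects (false ∷ x) (true ∷ y) = ofⁿ λ ()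

==V-refl : (x : V n) → (x ==V x) ≡ true
==V-refl x = Reflects-⇒true (==V-reflects x x) refl

==V-sym : (x y : V n) → (x ==V y) ≡ (y ==V x)
==V-sym x y = det (==V-reflects x y) (Reflects-map sym sym (==V-reflects y x))

sumAll : (V n → ℕ) → ℕ
sumAll {n} f = sum (List.map f (allVecs n))

sumAll-cong : {f g : V n → ℕ} → (∀ x → f x ≡ g x) → sumAll f ≡ sumAll g
sumAll-cong {n} f≗g = cong sum (map-cong f≗g (allVecs n))

sumAll-+ : (f g : V n → ℕ) → sumAll (λ x → f x + g x) ≡ sumAll f + sumAll g
sumAll-+ {n} f g = sum-map-+ f g (allVecs n)

sumAll-zero : (n : ℕ) → sumAll {n} (λ _ → 0) ≡ 0
sumAll-zero n = sum-map-zero (allVecs n)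

sumAll-suc : (f : V (suc n) → ℕ) → sumAll f ≡ sumAll (f ∘ (false ∷_)) + sumAll (f ∘ (true ∷_))
sumAll-suc {n} f = begin
  sumAll f
    ≡⟨ sum-map-concatMap f _ (allVecs n) ⟩
  sum (List.map (λ x → f (false ∷ x) + (f (true ∷ x) + 0)) (allVecs n))
    ≡⟨ sumAll-cong (λ x → cong (f (false ∷ x) +_) (+-identityʳ _)) ⟩
  sumAll (λ x → f (false ∷ x) + f (true ∷ x))
    ≡⟨ sumAll-+ (f ∘ (false ∷_)) (f ∘ (true ∷_)) ⟩
  sumAll (f ∘ (false ∷_)) + sumAll (f ∘ (true ∷_)) ∎

sumAll-point : (y : V n) (g : V n → ℕ) → sumAll (λ x → if x ==V y then g x else 0) ≡ g y
sumAll-point [] g = +-identityʳ (g [])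
sumAll-point {suc n} (false ∷ y) g = begin
  sumAll (λ x → if x ==V (false ∷ y) then g x else 0)
    ≡⟨ sumAll-suc {n} _ ⟩
  sumAll (λ x → if x ==V y then g (false ∷ x) else 0) + sumAll {n} (λ _ → 0)
    ≡⟨ cong₂ _+_ (sumAll-point y (g ∘ (false ∷_))) (sumAll-zero n) ⟩
  g (false ∷ y) + 0
    ≡⟨ +-identityʳ _ ⟩
  g (false ∷ y) ∎
sumAll-point {suc n} (true ∷ y) g = begin
  sumAll (λ x → if x ==V (true ∷ y) then g x else 0)
    ≡⟨ sumAll-suc {n} _ ⟩
  sumAll {n} (λ _ → 0) + sumAll (λ x → if x ==V y then g (true ∷ x) else 0)
    ≡⟨ cong₂ _+_ (sumAll-zero n) (sumAll-point y (g ∘ (true ∷_))) ⟩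
  g (true ∷ y) ∎

∈-allVecs : (x : V n) → x ∈ allVecs n
∈-allVecs [] = here refl
∈-allVecs (false ∷ x) = ∈-concatMap⁺ _ (Any.map (λ { refl → here refl }) (∈-allVecs x))
∈-allVecs (true ∷ x) = ∈-concatMap⁺ _ (Any.map (λ { refl → there (here refl) }) (∈-allVecs x))

comb-zeroV : (gs : Vec (V v) k) → comb (zeroV k) gs ≡ zeroV v
comb-zeroV [] = refl
comb-zeroV (g ∷ gs) = comb-zeroV gs

comb-+V : (c d : V k) (gs : Vec (V v) k) → comb (c +V d) gs ≡ comb c gs +V comb d gs
comb-+V [] [] [] = sym (+V-identityʳ _)
comb-+V (true ∷ c) (true ∷ d) (g ∷ gs) = begin
  comb (c +V d) gs                      ≡⟨ comb-+V c d gs ⟩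
  comb c gs +V comb d gs                ≡⟨ +V-identityˡ _ ⟨
  zeroV _ +V (comb c gs +V comb d gs)   ≡⟨ cong (_+V _) (+V-self g) ⟨
  (g +V g) +V (comb c gs +V comb d gs)  ≡⟨ +V-interchange g g _ _ ⟩
  (g +V comb c gs) +V (g +V comb d gs)  ∎
comb-+V (true ∷ c) (false ∷ d) (g ∷ gs) = trans (cong (g +V_) (comb-+V c d gs)) (sym (+V-assoc g _ _))
comb-+V (false ∷ c) (true ∷ d) (g ∷ gs) = trans (cong (g +V_) (comb-+V c d gs)) (+V-leftCommutative g _ _)
comb-+V (false ∷ c) (false ∷ d) (g ∷ gs) = comb-+V c d gs

comb-injective : {gs : Vec (V v) k} → Independent gs → (c d : V k) → comb c gs ≡ comb d gs → c ≡ d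
comb-injective {gs = gs} independent c d c≡d = +V≡zero⇒≡ c d (independent (c +V d) (begin
  comb (c +V d) gs        ≡⟨ comb-+V c d gs ⟩
  comb c gs +V comb d gs  ≡⟨ cong (_+V comb d gs) c≡d ⟩
  comb d gs +V comb d gs  ≡⟨ +V-self _ ⟩
  zeroV _                 ∎))

comb-==V : {gs : Vec (V v) k} → Independent gs → (c d : V k) → (comb c gs ==V comb d gs) ≡ (c ==V d)
comb-==V {gs = gs} independent c d = det (==V-reflects _ _)
  (Reflects-map (cong (λ e → comb e gs)) (comb-injective independent c d) (==V-reflects c d))

inSpan-reflects : (gs : Vec (V v) k) (x : V v) → Reflects (∃ λ c → comb c gs ≡ x) (inSpan gs x)
inSpan-reflects {k = k} gs x = fromEquivalence
  (λ t → let c , t′ = Any.satisfied (any⁻ _ (allVecs k) t)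
         in c , Reflects-true⇒ (==V-reflects _ x) (Equivalence.to T-≡ t′))
  (λ (c , c↦x) → any⁺ _ (Any.map (λ { refl → Equivalence.from T-≡ (Reflects-⇒true (==V-reflects _ x) c↦x) })
                                 (∈-allVecs c)))

_∈span?_ : (x : V v) (gs : Vec (V v) k) → Dec (∃ λ c → comb c gs ≡ x)
x ∈span? gs = inSpan gs x because inSpan-reflects gs x

inSpan-comb : (gs : Vec (V v) k) (c : V k) → inSpan gs (comb c gs) ≡ true
inSpan-comb gs c = Reflects-⇒true (inSpan-reflects gs _) (c , refl)

χ-nonzero : (gs : Vec (V v) k) {x : V v} → isNonzero x ≡ true → χ gs x ≡ (if inSpan gs x then 1 else 0)
χ-nonzero gs nz rewrite nz = refl

withCoordinates : Vec (V v) k → Vec (V k) l → Vec (V v) l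
withCoordinates E F = Vec.map (λ f → comb f E) F

comb-withCoordinates : (E : Vec (V v) k) (F : Vec (V k) l) (d : V l) →
  comb d (withCoordinates E F) ≡ comb (comb d F) E
comb-withCoordinates E [] [] = sym (comb-zeroV E)
comb-withCoordinates E (f ∷ F) (true ∷ d) =
  trans (cong (comb f E +V_) (comb-withCoordinates E F d)) (sym (comb-+V f (comb d F) E))
comb-withCoordinates E (f ∷ F) (false ∷ d) = comb-withCoordinates E F d

withCoordinates-independent : {E : Vec (V v) k} {F : Vec (V k) l} →
  Independent E → Independent F → Independent (withCoordinates E F)
withCoordinates-independent {E = E} {F} E-independent F-independent d d↦0 =
  F-independent d (comb-injective E-independent _ _ (begin
    comb (comb d F) E            ≡⟨ comb-withCoordinates E F d ⟨
    comb d (withCoordinates E F) ≡⟨ d↦0 ⟩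
    zeroV _                      ≡⟨ comb-zeroV E ⟨
    comb (zeroV _) E             ∎))

withCoordinates-≤S : (E : Vec (V v) k) (F : Vec (V k) l) → withCoordinates E F ≤S E
withCoordinates-≤S E F x x∈L with isNonzero x
... | true =
  let d , d↦x = Reflects-true⇒ (inSpan-reflects (withCoordinates E F) x) x∈L
  in Reflects-⇒true (inSpan-reflects E x) (comb d F , trans (sym (comb-withCoordinates E F d)) d↦x)

inSpan-withCoordinates : {E : Vec (V v) k} → Independent E → (F : Vec (V k) l) (c : V k) →
  inSpan (withCoordinates E F) (comb c E) ≡ inSpan F c
inSpan-withCoordinates {E = E} E-independent F c =
  det (inSpan-reflects (withCoordinates E F) (comb c E)) (Reflects-map to from (inSpan-reflects F c))
  where
  to : ∃ (λ d → comb d F ≡ c) → ∃ (λ d → comb d (withCoordinates E F) ≡ comb c E)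
  to (d , d↦c) = d , trans (comb-withCoordinates E F d) (cong (λ e → comb e E) d↦c)
  from : ∃ (λ d → comb d (withCoordinates E F) ≡ comb c E) → ∃ (λ d → comb d F ≡ c)
  from (d , d↦c) = d , comb-injective E-independent _ _ (trans (sym (comb-withCoordinates E F d)) d↦c)

-- Coordinate hyperplanes

e₀ : (n : ℕ) → V (suc n)
e₀ n = true ∷ zeroV n

standardBasis : (n : ℕ) → Vec (V n) n
standardBasis zero = []
standardBasis (suc n) = e₀ n ∷ Vec.map (false ∷_) (standardBasis n)

coordinateHyperplane : Fin (suc n) → Vec (V (suc n)) n
coordinateHyperplane {n} zero = Vec.map (false ∷_) (standardBasis n)
coordinateHyperplane {suc n} (suc i) = e₀ (suc n) ∷ Vec.map (false ∷_) (coordinateHyperplane i)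

comb-map-false∷ : (c : V k) (gs : Vec (V v) k) → comb c (Vec.map (false ∷_) gs) ≡ false ∷ comb c gs
comb-map-false∷ [] [] = refl
comb-map-false∷ (true ∷ c) (g ∷ gs) = cong ((false ∷ g) +V_) (comb-map-false∷ c gs)
comb-map-false∷ (false ∷ c) (g ∷ gs) = comb-map-false∷ c gs

comb-e₀∷ : (b : Bool) (c : V k) (gs : Vec (V v) k) →
  comb (b ∷ c) (e₀ v ∷ Vec.map (false ∷_) gs) ≡ b ∷ comb c gs
comb-e₀∷ true c gs = trans (cong (e₀ _ +V_) (comb-map-false∷ c gs)) (cong (true ∷_) (+V-identityˡ _))
comb-e₀∷ false c gs = comb-map-false∷ c gs

comb-standardBasis : (c : V n) → comb c (standardBasis n) ≡ c
comb-standardBasis [] = refl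
comb-standardBasis (b ∷ c) = trans (comb-e₀∷ b c _) (cong (b ∷_) (comb-standardBasis c))

comb-coordinateHyperplane : (i : Fin (suc n)) (c : V n) → comb c (coordinateHyperplane i) ≡ insertAt c i false
comb-coordinateHyperplane zero c = trans (comb-map-false∷ c _) (cong (false ∷_) (comb-standardBasis c))
comb-coordinateHyperplane {suc n} (suc i) (b ∷ c) =
  trans (comb-e₀∷ b c _) (cong (b ∷_) (comb-coordinateHyperplane i c))

insertAt-false≡zeroV : (c : V n) (i : Fin (suc n)) → insertAt c i false ≡ zeroV (suc n) → c ≡ zeroV n
insertAt-false≡zeroV c zero eq = ∷-injectiveʳ eq
insertAt-false≡zeroV (b ∷ c) (suc i) eq =
  cong₂ _∷_ (∷-injectiveˡ eq) (insertAt-false≡zeroV c i (∷-injectiveʳ eq))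

coordinateHyperplane-independent : (i : Fin (suc n)) → Independent (coordinateHyperplane i)
coordinateHyperplane-independent i c c↦0 =
  insertAt-false≡zeroV c i (trans (sym (comb-coordinateHyperplane i c)) c↦0)

inSpan-coordinateHyperplane : (i : Fin (suc n)) (x : V (suc n)) →
  inSpan (coordinateHyperplane i) x ≡ not (lookup x i)
inSpan-coordinateHyperplane i x with lookup x i in xᵢ
... | false = Reflects-⇒true (inSpan-reflects _ x) (removeAt x i , (begin
  comb (removeAt x i) (coordinateHyperplane i)  ≡⟨ comb-coordinateHyperplane i _ ⟩
  insertAt (removeAt x i) i false               ≡⟨ cong (insertAt (removeAt x i) i) xᵢ ⟨
  insertAt (removeAt x i) i (lookup x i)        ≡⟨ insertAt-removeAt x i ⟩
  x                                             ∎))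
... | true = Reflects-¬⇒false (inSpan-reflects _ x) λ (c , c↦x) →
  false≢true (begin
    false                                        ≡⟨ insertAt-lookup c i false ⟨
    lookup (insertAt c i false) i                ≡⟨ cong (λ y → lookup y i) (comb-coordinateHyperplane i c) ⟨
    lookup (comb c (coordinateHyperplane i)) i   ≡⟨ cong (λ y → lookup y i) c↦x ⟩
    lookup x i                                   ≡⟨ xᵢ ⟩
    true                                         ∎)
  where
  false≢true : false ≢ true
  false≢true ()

onPoints : Multiset v → Multiset v
onPoints M x = if isNonzero x then M x else 0

onPoints-nonzero : (M : Multiset v) {x : V v} → isNonzero x ≡ true → onPoints M x ≡ M x
onPoints-nonzero M {x} nz = cong (λ b → if b then M x else 0) nz

card≡sumAll : (M : Multiset v) → card M ≡ sumAll (onPoints M)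
card≡sumAll {v} M = sum-map-filterᵇ isNonzero M (allVecs v)

mult≡sumAll : (M : Multiset v) (gs : Vec (V v) k) → mult M gs ≡ sumAll (λ x → if isPointOf gs x then M x else 0)
mult≡sumAll {v} M gs = sum-map-filterᵇ (isPointOf gs) M (allVecs v)

onPoints-split : (M : Multiset (suc n)) (i : Fin (suc n)) (x : V (suc n)) →
  onPoints M x ≡ (if isPointOf (coordinateHyperplane i) x then M x else 0) + (if lookup x i then onPoints M x else 0)
onPoints-split M i x rewrite inSpan-coordinateHyperplane i x with isNonzero x | lookup x i
... | true | true = refl
... | true | false = sym (+-identityʳ (M x))
... | false | true = refl
... | false | false = refl

card≡mult+offHyperplane : (M : Multiset (suc n)) (i : Fin (suc n)) →
  card M ≡ mult M (coordinateHyperplane i) + sumAll (λ x → if lookup x i then onPoints M x else 0)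
card≡mult+offHyperplane M i = begin
  card M                                         ≡⟨ card≡sumAll M ⟩
  sumAll (onPoints M)                            ≡⟨ sumAll-cong (onPoints-split M i) ⟩
  sumAll (λ x → onH x + offH x)                  ≡⟨ sumAll-+ onH offH ⟩
  sumAll onH + sumAll offH                       ≡⟨ cong (_+ sumAll offH) (mult≡sumAll M (coordinateHyperplane i)) ⟨
  mult M (coordinateHyperplane i) + sumAll offH  ∎
  where
  onH offH : V _ → ℕ
  onH x = if isPointOf (coordinateHyperplane i) x then M x else 0
  offH x = if lookup x i then onPoints M x else 0

ofList : List (V v) → Multiset v
ofList ps x = sum (List.map (λ p → χpt p x) ps)

sumAll-ofList : (q : V v → Bool) (ps : List (V v)) →
  sumAll (λ x → if q x then ofList ps x else 0) ≡ length (filterᵇ q ps)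
sumAll-ofList {v} q [] = trans (sumAll-cong (λ x → if-eta (q x))) (sumAll-zero v)
sumAll-ofList q (p ∷ ps) = begin
  sumAll (λ x → if q x then χpt p x + ofList ps x else 0)
    ≡⟨ sumAll-cong (λ x → if-+ (q x) (χpt p x) (ofList ps x)) ⟩
  sumAll (λ x → (if q x then χpt p x else 0) + (if q x then ofList ps x else 0))
    ≡⟨ sumAll-+ (λ x → if q x then χpt p x else 0) _ ⟩
  sumAll (λ x → if q x then χpt p x else 0) + sumAll (λ x → if q x then ofList ps x else 0)
    ≡⟨ cong (_+ _) (sumAll-cong (λ x → if-swap-then (q x) (x ==V p))) ⟩
  sumAll (λ x → if x ==V p then (if q x then 1 else 0) else 0) + sumAll (λ x → if q x then ofList ps x else 0)
    ≡⟨ cong₂ _+_ (sumAll-point p (λ x → if q x then 1 else 0)) (sumAll-ofList q ps) ⟩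
  (if q p then 1 else 0) + length (filterᵇ q ps)
    ≡⟨ length-filterᵇ-∷ q p ps ⟨
  length (filterᵇ q (p ∷ ps)) ∎

ofList-replicate : (k : ℕ) (p y : V v) → ofList (List.replicate k p) y ≡ (if y ==V p then k else 0)
ofList-replicate zero p y = sym (if-eta (y ==V p))
ofList-replicate (suc k) p y with y ==V p in y≟p
... | true = cong suc (trans (ofList-replicate k p y) (cong (λ b → if b then k else 0) y≟p))
... | false = trans (ofList-replicate k p y) (cong (λ b → if b then k else 0) y≟p)

expand : Multiset v → List (V v)
expand {v} f = concatMap (λ x → List.replicate (f x) x) (allVecs v)

length-expand : (f : Multiset v) → length (expand f) ≡ sumAll f
length-expand {v} f = go (allVecs v)
  where
  go : (xs : List (V v)) → length (concatMap (λ x → List.replicate (f x) x) xs) ≡ sum (List.map f xs)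
  go [] = refl
  go (x ∷ xs) = trans (length-++ (List.replicate (f x) x)) (cong₂ _+_ (length-replicate (f x)) (go xs))

ofList-expand : (f : Multiset v) (y : V v) → ofList (expand f) y ≡ f y
ofList-expand {v} f y = begin
  ofList (expand f) y
    ≡⟨ sum-map-concatMap (λ p → χpt p y) _ (allVecs v) ⟩
  sumAll (λ x → ofList (List.replicate (f x) x) y)
    ≡⟨ sumAll-cong (λ x → trans (ofList-replicate (f x) x y) (cong (λ b → if b then f x else 0) (==V-sym y x))) ⟩
  sumAll (λ x → if x ==V y then f x else 0)
    ≡⟨ sumAll-point y f ⟩
  f y ∎

pointList : (M : Multiset v) →
  Σ (List (V v)) λ ps → length ps ≡ card M × (∀ x → onPoints M x ≡ ofList ps x)
pointList M = expand (onPoints M) ,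
  trans (length-expand (onPoints M)) (sym (card≡sumAll M)) , λ x → sym (ofList-expand (onPoints M) x)

ofList-∈ : {p : V v} {ps : List (V v)} → p ∈ ps → 0 < ofList ps p
ofList-∈ {p = p} (here refl) rewrite ==V-refl p = s≤s z≤n
ofList-∈ {p = p} {q ∷ ps} (there p∈ps) = <-≤-trans (ofList-∈ p∈ps) (m≤n+m _ (χpt q p))

ofList-∉ : {x : V v} {ps : List (V v)} → x ∉ ps → ofList ps x ≡ 0
ofList-∉ {ps = []} x∉ps = refl
ofList-∉ {x = x} {p ∷ ps} x∉ps
  rewrite Reflects-¬⇒false (==V-reflects x p) (x∉ps ∘ here) = ofList-∉ (x∉ps ∘ there)

ofList-↭ : {ps qs : List (V v)} → ps ↭ qs → (x : V v) → ofList ps x ≡ ofList qs x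
ofList-↭ ps↭qs x = sum-↭ (↭.map⁺ (λ p → χpt p x) ps↭qs)

ofList-map-injective : (f : V k → V v) → (∀ c d → (f c ==V f d) ≡ (c ==V d)) →
  (os : List (V k)) (c : V k) → ofList (List.map f os) (f c) ≡ ofList os c
ofList-map-injective f f-==V [] c = refl
ofList-map-injective f f-==V (o ∷ os) c =
  cong₂ _+_ (cong (λ b → if b then 1 else 0) (f-==V c o)) (ofList-map-injective f f-==V os c)

onPoints-support : {M : Multiset v} {ps : List (V v)} →
  (∀ x → onPoints M x ≡ ofList ps x) → All (λ p → isNonzero p ≡ true) ps
onPoints-support {M = M} {ps} M≗ps = All.tabulate nonzero
  where
  nonzero : {p : V _} → p ∈ ps → isNonzero p ≡ true
  nonzero {p} p∈ps with isNonzero p in nz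
  ... | true = refl
  ... | false = ⊥-elim (n≮n 0 (subst (0 <_) (trans (sym (M≗ps p)) (cong (λ b → if b then M p else 0) nz))
                                         (ofList-∈ p∈ps)))

-- The points of a 2-divisible multiset sum to zero

∑V : List (V v) → V v
∑V {v} = List.foldr _+V_ (zeroV v)

%2-suc : (n : ℕ) (b : Bool) → n % 2 ≡ (if b then 1 else 0) → suc n % 2 ≡ (if not b then 1 else 0)
%2-suc n b n%2 = begin
  (1 + n) % 2                        ≡⟨ %-distribˡ-+ 1 n 2 ⟩
  (1 + n % 2) % 2                    ≡⟨ cong (λ r → (1 + r) % 2) n%2 ⟩
  (1 + (if b then 1 else 0)) % 2     ≡⟨ flip b ⟩
  (if not b then 1 else 0)           ∎
  where
  flip : (b : Bool) → (1 + (if b then 1 else 0)) % 2 ≡ (if not b then 1 else 0)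
  flip true = refl
  flip false = refl

%2-summand : (m n : ℕ) → m % 2 ≡ (m + n) % 2 → n % 2 ≡ 0
%2-summand m n m≡m+n =
  remainders (m % 2) (n % 2) (m%n<n m 2) (m%n<n n 2) (trans m≡m+n (%-distribˡ-+ m n 2))
  where
  remainders : (r s : ℕ) → r < 2 → s < 2 → r ≡ (r + s) % 2 → s ≡ 0
  remainders r 0 _ _ _ = refl
  remainders 0 1 _ _ ()
  remainders 1 1 _ _ ()
  remainders (suc (suc r)) s (s≤s (s≤s ())) _ _
  remainders r (suc (suc s)) _ (s≤s (s≤s ())) _

count-parity : {v : ℕ} (ps : List (V v)) (i : Fin v) →
  length (filterᵇ (λ p → lookup p i) ps) % 2 ≡ (if lookup (∑V ps) i then 1 else 0)
count-parity [] i rewrite lookup-replicate i false = refl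
count-parity (p ∷ ps) i rewrite lookup-zipWith _xor_ i p (∑V ps) with lookup p i
... | true = %2-suc (length (filterᵇ (λ p → lookup p i) ps)) _ (count-parity ps i)
... | false = count-parity ps i

lookup-false⇒zeroV : (x : V n) → (∀ i → lookup x i ≡ false) → x ≡ zeroV n
lookup-false⇒zeroV [] _ = refl
lookup-false⇒zeroV (b ∷ x) xᵢ≡false = cong₂ _∷_ (xᵢ≡false zero) (lookup-false⇒zeroV x (xᵢ≡false ∘ suc))

divisible⇒∑V≡zeroV : {M : Multiset v} {ps : List (V v)} →
  Divisible 2 M → (∀ x → onPoints M x ≡ ofList ps x) → ∑V ps ≡ zeroV v
divisible⇒∑V≡zeroV {zero} {ps = ps} _ _ = lookup-false⇒zeroV (∑V ps) λ ()
divisible⇒∑V≡zeroV {suc _} {M} {ps} M-divisible M≗ps = lookup-false⇒zeroV (∑V ps) coordinate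
  where
  indicator≡0 : (b : Bool) → (if b then 1 else 0) ≡ 0 → b ≡ false
  indicator≡0 false _ = refl
  -- By divisibility the number of points off the hyperplane xᵢ = 0 is even.
  coordinate : (i : Fin _) → lookup (∑V ps) i ≡ false
  coordinate i = indicator≡0 _ (trans (sym (count-parity ps i)) (%2-summand (mult M H) _ (begin
    mult M H % 2  ≡⟨ M-divisible H (coordinateHyperplane-independent i) ⟩
    card M % 2    ≡⟨ cong (_% 2) (card≡mult+offHyperplane M i) ⟩
    (mult M H + sumAll (λ x → if lookup x i then onPoints M x else 0)) % 2
                  ≡⟨ cong (λ w → (mult M H + w) % 2)
                        (trans (sumAll-cong (λ x → cong (λ m → if lookup x i then m else 0) (M≗ps x)))
                               (sumAll-ofList (λ x → lookup x i) ps)) ⟩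
    (mult M H + length (filterᵇ (λ p → lookup p i) ps)) % 2 ∎)))
    where
    H = coordinateHyperplane i

-- Four points with zero sum

DoubledPair : Multiset v → Set
DoubledPair {v} M = Σ (V v) λ P₁ → Σ (V v) λ P₂ → isNonzero P₁ ≡ true × isNonzero P₂ ≡ true ×
  (M ≈M (λ x → 2 * χpt P₁ x + 2 * χpt P₂ x))

PlaneMinusLine : Multiset v → Set
PlaneMinusLine {v} M = Σ (Vec (V v) 3) λ E → Σ (Vec (V v) 2) λ L →
  Independent E × Independent L × (L ≤S E) × (M ≈M (λ x → χ E x ∸ χ L x))

doubledPair : {M : Multiset v} {ps : List (V v)} (p q : V v) → isNonzero p ≡ true → isNonzero q ≡ true →
  ps ↭ p ∷ p ∷ q ∷ q ∷ [] → (∀ x → onPoints M x ≡ ofList ps x) → DoubledPair M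
doubledPair {M = M} {ps} p q nz-p nz-q ps↭ppqq M≗ps = p , q , nz-p , nz-q , λ x nz-x → begin
  M x                            ≡⟨ onPoints-nonzero M nz-x ⟨
  onPoints M x                   ≡⟨ M≗ps x ⟩
  ofList ps x                    ≡⟨ ofList-↭ ps↭ppqq x ⟩
  ofList (p ∷ p ∷ q ∷ q ∷ []) x  ≡⟨ twice (χpt p x) (χpt q x) ⟩
  2 * χpt p x + 2 * χpt q x      ∎
  where
  twice : (m n : ℕ) → m + (m + (n + (n + 0))) ≡ 2 * m + 2 * n
  twice = solve-∀

triple-independent : {a b c : V v} →
  isNonzero a ≡ true → isNonzero b ≡ true → isNonzero c ≡ true → isNonzero (a +V (b +V c)) ≡ true →
  a ≢ b → a ≢ c → b ≢ c → Independent (a ∷ b ∷ c ∷ [])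
triple-independent _ _ _ _ _ _ _ (false ∷ false ∷ false ∷ []) _ = refl
triple-independent {a = a} nz-a _ _ _ _ _ _ (true ∷ false ∷ false ∷ []) a↦0 =
  ⊥-elim (nonzero⇒≢zeroV nz-a (trans (sym (+V-identityʳ a)) a↦0))
triple-independent {b = b} _ nz-b _ _ _ _ _ (false ∷ true ∷ false ∷ []) b↦0 =
  ⊥-elim (nonzero⇒≢zeroV nz-b (trans (sym (+V-identityʳ b)) b↦0))
triple-independent {c = c} _ _ nz-c _ _ _ _ (false ∷ false ∷ true ∷ []) c↦0 =
  ⊥-elim (nonzero⇒≢zeroV nz-c (trans (sym (+V-identityʳ c)) c↦0))
triple-independent {b = b} _ _ _ _ a≢b _ _ (true ∷ true ∷ false ∷ []) a+b↦0 =
  ⊥-elim (a≢b (trans (+V≡zero⇒≡ _ _ a+b↦0) (+V-identityʳ b)))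
triple-independent {c = c} _ _ _ _ _ a≢c _ (true ∷ false ∷ true ∷ []) a+c↦0 =
  ⊥-elim (a≢c (trans (+V≡zero⇒≡ _ _ a+c↦0) (+V-identityʳ c)))
triple-independent {c = c} _ _ _ _ _ _ b≢c (false ∷ true ∷ true ∷ []) b+c↦0 =
  ⊥-elim (b≢c (trans (+V≡zero⇒≡ _ _ b+c↦0) (+V-identityʳ c)))
triple-independent {a = a} {b} {c} _ _ _ nz-a+b+c _ _ _ (true ∷ true ∷ true ∷ []) a+b+c↦0 =
  ⊥-elim (nonzero⇒≢zeroV nz-a+b+c (trans (cong (λ z → a +V (b +V z)) (sym (+V-identityʳ c))) a+b+c↦0))

ofList-complement : {E : Vec (V v) k} → Independent E → (F : Vec (V k) l) (os : List (V k)) →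
  (∀ c → ofList os c ≡ 1 ∸ (if inSpan F c then 1 else 0)) →
  (x : V v) → isNonzero x ≡ true →
  ofList (List.map (λ o → comb o E) os) x ≡ χ E x ∸ χ (withCoordinates E F) x
ofList-complement {E = E} E-independent F os os-complement x nz with x ∈span? E
... | yes (c , refl) = begin
  ofList (List.map (λ o → comb o E) os) (comb c E)  ≡⟨ ofList-map-injective _ (comb-==V E-independent) os c ⟩
  ofList os c                                       ≡⟨ os-complement c ⟩
  1 ∸ (if inSpan F c then 1 else 0)                 ≡⟨ cong₂ _∸_ χE≡1 χL≡ ⟨
  χ E (comb c E) ∸ χ (withCoordinates E F) (comb c E) ∎
  where
  χE≡1 : χ E (comb c E) ≡ 1
  χE≡1 = trans (χ-nonzero E nz) (cong (λ b → if b then 1 else 0) (inSpan-comb E c))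
  χL≡ : χ (withCoordinates E F) (comb c E) ≡ (if inSpan F c then 1 else 0)
  χL≡ = trans (χ-nonzero (withCoordinates E F) nz) (cong (λ b → if b then 1 else 0) (inSpan-withCoordinates E-independent F c))
... | no x∉E = begin
  ofList (List.map (λ o → comb o E) os) x  ≡⟨ ofList-∉ x∉image ⟩
  0                                        ≡⟨ 0∸n≡0 (χ (withCoordinates E F) x) ⟨
  0 ∸ χ (withCoordinates E F) x            ≡⟨ cong (_∸ χ (withCoordinates E F) x) χE≡0 ⟨
  χ E x ∸ χ (withCoordinates E F) x        ∎
  where
  χE≡0 : χ E x ≡ 0
  χE≡0 = trans (χ-nonzero E nz) (cong (λ b → if b then 1 else 0) (Reflects-¬⇒false (inSpan-reflects E x) x∉E))
  x∉image : x ∉ List.map (λ o → comb o E) os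
  x∉image x∈image with o , _ , x≡ ← ∈-map⁻ _ x∈image = x∉E (o , sym x≡)

-- In coordinates with respect to a basis a, b, c of a plane, the points a, b, c, a + b + c are the
-- vectors of odd weight; the even ones form the line spanned by a + b and a + c.
line₃ : Vec (V 3) 2
line₃ = (true ∷ true ∷ false ∷ []) ∷ (true ∷ false ∷ true ∷ []) ∷ []

offLine₃ : List (V 3)
offLine₃ = (true ∷ false ∷ false ∷ []) ∷ (false ∷ true ∷ false ∷ []) ∷ (false ∷ false ∷ true ∷ [])
         ∷ (true ∷ true ∷ true ∷ []) ∷ []

line₃-independent : Independent line₃
line₃-independent (false ∷ false ∷ []) _ = refl
line₃-independent (true ∷ false ∷ []) ()
line₃-independent (false ∷ true ∷ []) ()
line₃-independent (true ∷ true ∷ []) ()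

offLine₃-complement : (c : V 3) → ofList offLine₃ c ≡ 1 ∸ (if inSpan line₃ c then 1 else 0)
offLine₃-complement (false ∷ false ∷ false ∷ []) = refl
offLine₃-complement (false ∷ false ∷ true ∷ []) = refl
offLine₃-complement (false ∷ true ∷ false ∷ []) = refl
offLine₃-complement (false ∷ true ∷ true ∷ []) = refl
offLine₃-complement (true ∷ false ∷ false ∷ []) = refl
offLine₃-complement (true ∷ false ∷ true ∷ []) = refl
offLine₃-complement (true ∷ true ∷ false ∷ []) = refl
offLine₃-complement (true ∷ true ∷ true ∷ []) = refl

planeMinusLine : {M : Multiset v} {a b c : V v} →
  isNonzero a ≡ true → isNonzero b ≡ true → isNonzero c ≡ true → isNonzero (a +V (b +V c)) ≡ true →
  a ≢ b → a ≢ c → b ≢ c →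
  (∀ x → onPoints M x ≡ ofList (a ∷ b ∷ c ∷ a +V (b +V c) ∷ []) x) → PlaneMinusLine M
planeMinusLine {M = M} {a} {b} {c} nz-a nz-b nz-c nz-a+b+c a≢b a≢c b≢c M≗abcd =
  E , withCoordinates E line₃ , E-independent ,
  withCoordinates-independent E-independent line₃-independent , withCoordinates-≤S E line₃ ,
  λ x nz-x → begin
    M x                                               ≡⟨ onPoints-nonzero M nz-x ⟨
    onPoints M x                                      ≡⟨ M≗abcd x ⟩
    ofList (a ∷ b ∷ c ∷ a +V (b +V c) ∷ []) x        ≡⟨ cong (λ ps → ofList ps x) abcd≡image ⟩
    ofList (List.map (λ o → comb o E) offLine₃) x     ≡⟨ ofList-complement E-independent line₃ offLine₃
                                                            offLine₃-complement x nz-x ⟩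
    χ E x ∸ χ (withCoordinates E line₃) x             ∎
  where
  E : Vec (V _) 3
  E = a ∷ b ∷ c ∷ []
  E-independent : Independent E
  E-independent = triple-independent nz-a nz-b nz-c nz-a+b+c a≢b a≢c b≢c
  abcd≡image : a ∷ b ∷ c ∷ a +V (b +V c) ∷ [] ≡ List.map (λ o → comb o E) offLine₃
  abcd≡image = sym (cong₂ _∷_ (+V-identityʳ a) (cong₂ _∷_ (+V-identityʳ b) (cong₂ _∷_ (+V-identityʳ c)
    (cong (λ z → a +V (b +V z) ∷ []) (+V-identityʳ c)))))

fourth≡sum : (a b c d : V v) → ∑V (a ∷ b ∷ c ∷ d ∷ []) ≡ zeroV v → d ≡ a +V (b +V c)
fourth≡sum a b c d ∑≡0 = sym (+V≡zero⇒≡ _ _ (begin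
  (a +V (b +V c)) +V d           ≡⟨ +V-assoc a (b +V c) d ⟩
  a +V ((b +V c) +V d)           ≡⟨ cong (a +V_) (+V-assoc b c d) ⟩
  a +V (b +V (c +V d))           ≡⟨ cong (λ z → a +V (b +V (c +V z))) (+V-identityʳ d) ⟨
  ∑V (a ∷ b ∷ c ∷ d ∷ [])        ≡⟨ ∑≡0 ⟩
  zeroV _                        ∎))

fourPoints : {M : Multiset v} (ps : List (V v)) → length ps ≡ 4 → (∀ x → onPoints M x ≡ ofList ps x) →
  ∑V ps ≡ zeroV v → DoubledPair M ⊎ PlaneMinusLine M
fourPoints {M = M} (a ∷ b ∷ c ∷ d ∷ []) refl M≗ps ∑≡0
  with nz-a ∷ nz-b ∷ nz-c ∷ nz-d ∷ [] ← onPoints-support {M = M} {a ∷ b ∷ c ∷ d ∷ []} M≗ps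
  with refl ← fourth≡sum a b c d ∑≡0
  with ≡-dec _≟_ a b | ≡-dec _≟_ a c | ≡-dec _≟_ b c
... | yes refl | _ | _ =
  inj₁ (doubledPair a c nz-a nz-c (↭.↭-reflexive (cong (λ z → a ∷ a ∷ c ∷ z ∷ []) (+V-cancelˡ a c))) M≗ps)
... | no _ | yes refl | _ =
  inj₁ (doubledPair a b nz-a nz-b
    (↭.↭-trans (↭.↭-reflexive (cong (λ z → a ∷ b ∷ a ∷ z ∷ []) a+b+a≡b)) (prep a (swap b a ↭.refl))) M≗ps)
  where
  a+b+a≡b : a +V (b +V a) ≡ b
  a+b+a≡b = trans (+V-leftCommutative a b a) (trans (cong (b +V_) (+V-self a)) (+V-identityʳ b))
... | no _ | no _ | yes refl =
  inj₁ (doubledPair a b nz-a nz-b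
    (↭.↭-trans (↭.↭-reflexive (cong (λ z → a ∷ b ∷ b ∷ z ∷ []) a+b+b≡a))
               (prep a (↭.↭-trans (prep b (swap b a ↭.refl)) (swap b a ↭.refl)))) M≗ps)
  where
  a+b+b≡a : a +V (b +V b) ≡ a
  a+b+b≡a = trans (cong (a +V_) (+V-self b)) (+V-identityʳ a)
... | no a≢b | no a≢c | no b≢c = inj₂ (planeMinusLine nz-a nz-b nz-c nz-d a≢b a≢c b≢c M≗ps)

proposition16 : (v : ℕ) (M : Multiset v) → Divisible 2 M → card M ≡ 4 →
    (Σ (V v) λ P₁ → Σ (V v) λ P₂ → isNonzero P₁ ≡ true × isNonzero P₂ ≡ true ×
        (M ≈M (λ x → 2 * χpt P₁ x + 2 * χpt P₂ x)))
    ⊎ (Σ (Vec (V v) 3) λ E → Σ (Vec (V v) 2) λ L →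
        Independent E × Independent L × (L ≤S E) ×
        (M ≈M (λ x → χ E x ∸ χ L x)))
proposition16 v M M-divisible #M≡4 =
  let ps , |ps|≡#M , M≗ps = pointList M
  in fourPoints ps (trans |ps|≡#M #M≡4) M≗ps (divisible⇒∑V≡zeroV {ps = ps} M-divisible M≗ps)
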